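{- For all conditional propositions $X,Y,Z$ and every finite (possibly empty) sequence $\Gamma$: (i) $\vDash\lfloor\neg X|[X]X\rfloor$; in particular, if $\vDash\lfloor\Gamma|[X]X\leftrightarrow X\rfloor$ then $\vDash\lfloor\Gamma|\neg X|X\rfloor$; (ii) if $\vDash\lfloor\Gamma|[X]Y\leftrightarrow Y\rfloor$ and $\vDash\lfloor\Gamma|X\to Y\rfloor$ then $\vDash\lfloor\Gamma|\neg X|Y\rfloor$; (iii) if $\vDash\lfloor\Gamma|[X]Y\leftrightarrow Y\rfloor$ and $\vDash\lfloor\Gamma|X\vee Y\rfloor$ then $\vDash\lfloor\Gamma|X|Y\rfloor$; (iv) if $\vDash\lfloor\Gamma|(X\wedge Y)\to(X\wedge Z)\rfloor$, $\vDash\lfloor\Gamma|[X]Y\leftrightarrow Y\rfloor$ and $\vDash\lfloor\Gamma|[X]Z\leftrightarrow Z\rfloor$ then $\vDash\lfloor\Gamma|\neg X|Y\to Z\rfloor$.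
   Context: $\mathcal{C}$: smallest set containing $\bot$ and a set of atoms, closed under $X\to Y$ and $[X]Y$; $\neg X:=X\to\bot$, $X\vee Y:=\neg X\to Y$, $X\wedge Y:=\neg(\neg X\vee\neg Y)$, $\top:=\neg\bot$, $X\leftrightarrow Y:=(X\to Y)\wedge(Y\to X)$. A Bayesian algebra is a Boolean algebra $(E,\cap,\cup,\sim,\bot,\top)$ with $[\;]:E\times E\to E$ such that for all $x,y$: $z\mapsto[x]z$ is a Boolean automorphism; $x\subset y$ implies $[x]y=\top$ or $x=\bot$; $x\cap[x]y=x\cap y$; $[x][x]y=[\sim x][x]y=[x]y$. A valuation in $E$ is $H:\mathcal{C}\to E$ with $H(\bot)=\bot$, $H(X\to Y)=\sim H(X)\cup H(Y)$, $H([X]Y)=[H(X)]H(Y)$. $\vDash\lfloor X_1|\cdots|X_n\rfloor$ means: for every Bayesian algebra $E$ and every valuation $H$ in $E$ there is $i$ with $H(X_i)=\top$. -}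

module Defs where

open import Level using (Level; _⊔_; Setω) renaming (suc to lsuc)
open import Data.List using (List; []; _∷_; _++_)
open import Data.List.Relation.Unary.Any using (Any)
open import Data.Product using (Σ; _×_)
open import Data.Sum using (_⊎_)
open import Algebra.Lattice.Bundles using (BooleanAlgebra)

infixr 5 _⇒_
data Cond (A : Set) : Set where
  atom : A → Cond A
  ⊥c   : Cond A
  _⇒_  : Cond A → Cond A → Cond A
  [_]_ : Cond A → Cond A → Cond A

module _ {A : Set} where
  ¬c_ : Cond A → Cond A
  ¬c X = X ⇒ ⊥c

  _∨c_ : Cond A → Cond A → Cond A
  X ∨c Y = (¬c X) ⇒ Y

  _∧c_ : Cond A → Cond A → Cond A
  X ∧c Y = ¬c ((¬c X) ∨c (¬c Y))

  ⊤c : Cond A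
  ⊤c = ¬c ⊥c

  _⇔c_ : Cond A → Cond A → Cond A
  X ⇔c Y = (X ⇒ Y) ∧c (Y ⇒ X)

record BayesianAlgebra (c ℓ : Level) : Set (lsuc (c ⊔ ℓ)) where
  field
    boolean : BooleanAlgebra c ℓ
  open BooleanAlgebra boolean public
  field
    ⟦_⟧_ : Carrier → Carrier → Carrier
    cond-cong : ∀ {x x′ y y′} → x ≈ x′ → y ≈ y′ → (⟦ x ⟧ y) ≈ (⟦ x′ ⟧ y′)
    -- z ↦ [x]z is a Boolean automorphism
    aut-∧ : ∀ x y z → (⟦ x ⟧ (y ∧ z)) ≈ ((⟦ x ⟧ y) ∧ (⟦ x ⟧ z))
    aut-∨ : ∀ x y z → (⟦ x ⟧ (y ∨ z)) ≈ ((⟦ x ⟧ y) ∨ (⟦ x ⟧ z))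
    aut-¬ : ∀ x y → (⟦ x ⟧ (¬ y)) ≈ (¬ (⟦ x ⟧ y))
    aut-⊤ : ∀ x → (⟦ x ⟧ ⊤) ≈ ⊤
    aut-⊥ : ∀ x → (⟦ x ⟧ ⊥) ≈ ⊥
    aut-inj : ∀ x y z → (⟦ x ⟧ y) ≈ (⟦ x ⟧ z) → y ≈ z
    aut-surj : ∀ x w → Σ Carrier (λ z → (⟦ x ⟧ z) ≈ w)
    incl : ∀ x y → (x ∧ y) ≈ x → ((⟦ x ⟧ y) ≈ ⊤) ⊎ (x ≈ ⊥)
    meet : ∀ x y → (x ∧ (⟦ x ⟧ y)) ≈ (x ∧ y)
    idem : ∀ x y → (⟦ x ⟧ (⟦ x ⟧ y)) ≈ (⟦ x ⟧ y)
    neg  : ∀ x y → (⟦ ¬ x ⟧ (⟦ x ⟧ y)) ≈ (⟦ x ⟧ y)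

record Valuation {c ℓ : Level} (A : Set) (E : BayesianAlgebra c ℓ) : Set (c ⊔ ℓ) where
  open BayesianAlgebra E
  field
    H     : Cond A → Carrier
    H-⊥   : H ⊥c ≈ ⊥
    H-⇒   : ∀ X Y → H (X ⇒ Y) ≈ ((¬ H X) ∨ H Y)
    H-[]  : ∀ X Y → H ([ X ] Y) ≈ (⟦ H X ⟧ H Y)

-- Validity of a finite sequence ⌊X₁|⋯|Xₙ⌋ (a list), over all
-- Bayesian algebras at all universe levels.

⊨ : {A : Set} → List (Cond A) → Setω
⊨ {A} Γ = ∀ {c ℓ} (E : BayesianAlgebra c ℓ) (V : Valuation A E) →
  Any (λ X → BayesianAlgebra._≈_ E (Valuation.H V X) (BayesianAlgebra.⊤ E)) Γ

infixr 2 _×ω_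
record _×ω_ (P Q : Setω) : Setω where
  constructor _,ω_
  field
    fst : P
    snd : Q

module Submission where

-- Every part of the theorem rests on one fact about a Bayesian algebra E:
-- if b is independent of a ([a]b = b) and a ⊆ b, then ∼a = ⊤ or b = ⊤.
-- Indeed the axiom on inclusions gives [a]b = ⊤ or a = ⊥, and [a]b = b.
-- Its special case without independence, "[a]a = ⊤ or ∼a = ⊤", gives (i).

open import Defs
open import Data.List using (List; []; _∷_; _++_)
open import Level using (Level)
open import Data.Sum using (_⊎_; inj₁; inj₂)
open import Data.List.Relation.Unary.Any using (Any; here; there)
open import Data.List.Relation.Unary.Any.Properties using (++⁺ˡ; ++⁺ʳ; ++⁻)
open import Algebra.Lattice.Bundles using (BooleanAlgebra)
import Algebra.Lattice.Properties.BooleanAlgebra as BooleanAlgebraProperties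
import Relation.Binary.Reasoning.Setoid as SetoidReasoning

-- Reading ¬ a ∨ b ≈ ⊤ as "a → b is valid" and a ∧ b ≈ a as "a ⊆ b".
module BooleanFacts {c ℓ : Level} (B : BooleanAlgebra c ℓ) where
  open BooleanAlgebra B
  open BooleanAlgebraProperties B
  open SetoidReasoning setoid

  ∧-valid-left : ∀ {x y} → (x ∧ y) ≈ ⊤ → x ≈ ⊤
  ∧-valid-left {x} {y} p = begin
    x           ≈⟨ sym (∨-absorbs-∧ x y) ⟩
    x ∨ (x ∧ y) ≈⟨ ∨-congˡ p ⟩
    x ∨ ⊤       ≈⟨ ∨-zeroʳ x ⟩
    ⊤           ∎

  ∧-valid-right : ∀ {x y} → (x ∧ y) ≈ ⊤ → y ≈ ⊤
  ∧-valid-right {x} {y} p = ∧-valid-left (trans (∧-comm y x) p)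

  implication-inclusion : ∀ {a b} → ((¬ a) ∨ b) ≈ ⊤ → (a ∧ b) ≈ a
  implication-inclusion {a} {b} p = begin
    a ∧ b               ≈⟨ sym (∨-identityʳ _) ⟩
    (a ∧ b) ∨ ⊥         ≈⟨ ∨-congˡ (sym (∧-complementʳ a)) ⟩
    (a ∧ b) ∨ (a ∧ ¬ a) ≈⟨ sym (∧-distribˡ-∨ a b (¬ a)) ⟩
    a ∧ (b ∨ ¬ a)       ≈⟨ ∧-congˡ (trans (∨-comm b (¬ a)) p) ⟩
    a ∧ ⊤               ≈⟨ ∧-identityʳ a ⟩
    a                   ∎

  biconditional-equality : ∀ {a b} → (((¬ a) ∨ b) ∧ ((¬ b) ∨ a)) ≈ ⊤ → a ≈ b
  biconditional-equality {a} {b} p = begin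
    a     ≈⟨ sym (implication-inclusion (∧-valid-left p)) ⟩
    a ∧ b ≈⟨ ∧-comm a b ⟩
    b ∧ a ≈⟨ implication-inclusion (∧-valid-right p) ⟩
    b     ∎

  curry-implication : ∀ {a b c} →
    ((¬ (a ∧ b)) ∨ (a ∧ c)) ≈ ⊤ → ((¬ a) ∨ ((¬ b) ∨ c)) ≈ ⊤
  curry-implication {a} {b} {c} p = trans (sym (∨-assoc _ _ _)) (∧-valid-right (begin
    (((¬ a) ∨ (¬ b)) ∨ a) ∧ (((¬ a) ∨ (¬ b)) ∨ c)
      ≈⟨ sym (∨-distribˡ-∧ _ a c) ⟩
    ((¬ a) ∨ (¬ b)) ∨ (a ∧ c)
      ≈⟨ ∨-congʳ (sym (deMorgan₁ a b)) ⟩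
    (¬ (a ∧ b)) ∨ (a ∧ c)
      ≈⟨ p ⟩
    ⊤ ∎))

  ¬-valid : ∀ {a} → a ≈ ⊥ → (¬ a) ≈ ⊤
  ¬-valid p = trans (¬-cong p) ¬⊥≈⊤

  ¬¬-valid : ∀ {a} → (¬ (¬ a)) ≈ ⊤ → a ≈ ⊤
  ¬¬-valid {a} p = trans (sym (¬-involutive a)) p

module BayesianFacts {c ℓ : Level} (E : BayesianAlgebra c ℓ) where
  open BayesianAlgebra E
  open BooleanAlgebraProperties boolean
  open BooleanFacts boolean
  open SetoidReasoning setoid

  Independent : Carrier → Carrier → Set ℓ
  Independent a b = (⟦ a ⟧ b) ≈ b

  independent-resp : ∀ {a b b′} → b ≈ b′ → Independent a b → Independent a b′
  independent-resp {a} {b} {b′} e i = begin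
    ⟦ a ⟧ b′ ≈⟨ cond-cong refl (sym e) ⟩
    ⟦ a ⟧ b  ≈⟨ i ⟩
    b        ≈⟨ e ⟩
    b′       ∎

  -- Independence is closed under the Boolean operations used by "→",
  -- because z ↦ [a]z is a Boolean automorphism.
  independent-implication : ∀ {a b b′} → Independent a b → Independent a b′ →
    Independent a ((¬ b) ∨ b′)
  independent-implication {a} {b} {b′} i i′ = begin
    ⟦ a ⟧ ((¬ b) ∨ b′)          ≈⟨ aut-∨ a (¬ b) b′ ⟩
    (⟦ a ⟧ (¬ b)) ∨ (⟦ a ⟧ b′)  ≈⟨ ∨-congʳ (aut-¬ a b) ⟩
    (¬ (⟦ a ⟧ b)) ∨ (⟦ a ⟧ b′)  ≈⟨ ∨-cong (¬-cong i) i′ ⟩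
    (¬ b) ∨ b′                  ∎

  -- Independence of a entails independence of ∼a: [∼a]b = [∼a][a]b = [a]b = b.
  independent-complement : ∀ {a b} → Independent a b → Independent (¬ a) b
  independent-complement {a} {b} i = begin
    ⟦ ¬ a ⟧ b             ≈⟨ cond-cong refl (sym i) ⟩
    ⟦ ¬ a ⟧ (⟦ a ⟧ b)     ≈⟨ neg a b ⟩
    ⟦ a ⟧ b               ≈⟨ i ⟩
    b                     ∎

  inclusion-dichotomy : ∀ {a b} → (a ∧ b) ≈ a → ((⟦ a ⟧ b) ≈ ⊤) ⊎ ((¬ a) ≈ ⊤)
  inclusion-dichotomy {a} {b} a⊆b with incl a b a⊆b
  ... | inj₁ conditional-valid = inj₁ conditional-valid
  ... | inj₂ a≈⊥               = inj₂ (¬-valid a≈⊥)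

  self-conditional : ∀ a → ((⟦ a ⟧ a) ≈ ⊤) ⊎ ((¬ a) ≈ ⊤)
  self-conditional a = inclusion-dichotomy (∧-idem a)

  independent-consequence : ∀ {a b} → Independent a b → (a ∧ b) ≈ a →
    ((¬ a) ≈ ⊤) ⊎ (b ≈ ⊤)
  independent-consequence {a} {b} i a⊆b with inclusion-dichotomy a⊆b
  ... | inj₁ conditional-valid = inj₂ (trans (sym i) conditional-valid)
  ... | inj₂ ¬a-valid          = inj₁ ¬a-valid

module Pointwise {c ℓ : Level} (E : BayesianAlgebra c ℓ) {A : Set} (V : Valuation A E) where
  open BayesianAlgebra E
  open BooleanAlgebraProperties boolean
  open BooleanFacts boolean
  open BayesianFacts E
  open Valuation V
  open SetoidReasoning setoid

  Holds : Cond A → Set ℓ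
  Holds X = H X ≈ ⊤

  H-¬ : ∀ X → H (¬c X) ≈ ¬ H X
  H-¬ X = trans (H-⇒ X ⊥c) (trans (∨-congˡ H-⊥) (∨-identityʳ _))

  H-∧ : ∀ X Y → H (X ∧c Y) ≈ (H X ∧ H Y)
  H-∧ X Y = begin
    H (X ∧c Y)                          ≈⟨ H-¬ _ ⟩
    ¬ H ((¬c (¬c X)) ⇒ (¬c Y))          ≈⟨ ¬-cong (H-⇒ _ _) ⟩
    ¬ ((¬ H (¬c (¬c X))) ∨ H (¬c Y))    ≈⟨ ¬-cong (∨-cong ¬¬¬X (H-¬ Y)) ⟩
    ¬ ((¬ H X) ∨ (¬ H Y))               ≈⟨ deMorgan₂ _ _ ⟩
    (¬ (¬ H X)) ∧ (¬ (¬ H Y))           ≈⟨ ∧-cong (¬-involutive _) (¬-involutive _) ⟩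
    H X ∧ H Y                           ∎
    where
    ¬¬¬X : (¬ H (¬c (¬c X))) ≈ (¬ H X)
    ¬¬¬X = trans (¬-cong (trans (H-¬ _) (¬-cong (H-¬ X)))) (¬-involutive _)

  ¬c-holds : ∀ {X} → (¬ H X) ≈ ⊤ → Holds (¬c X)
  ¬c-holds {X} p = trans (H-¬ X) p

  implication-holds : ∀ {X Y} → Holds (X ⇒ Y) → (H X ∧ H Y) ≈ H X
  implication-holds {X} {Y} p = implication-inclusion (trans (sym (H-⇒ X Y)) p)

  biconditional-holds : ∀ {X Y} → Holds (X ⇔c Y) → H X ≈ H Y
  biconditional-holds {X} {Y} p =
    biconditional-equality (trans (sym (∧-cong (H-⇒ X Y) (H-⇒ Y X))) (trans (sym (H-∧ _ _)) p))

  independence-holds : ∀ {X Y} → Holds (([ X ] Y) ⇔c Y) → Independent (H X) (H Y)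
  independence-holds {X} {Y} p = trans (sym (H-[] X Y)) (biconditional-holds p)

  curry-holds : ∀ {X Y Z} → Holds ((X ∧c Y) ⇒ (X ∧c Z)) → Holds (X ⇒ (Y ⇒ Z))
  curry-holds {X} {Y} {Z} p = begin
    H (X ⇒ (Y ⇒ Z))               ≈⟨ H-⇒ X _ ⟩
    (¬ H X) ∨ H (Y ⇒ Z)           ≈⟨ ∨-congˡ (H-⇒ Y Z) ⟩
    (¬ H X) ∨ ((¬ H Y) ∨ H Z)     ≈⟨ curry-implication premise ⟩
    ⊤                             ∎
    where
    premise : ((¬ (H X ∧ H Y)) ∨ (H X ∧ H Z)) ≈ ⊤
    premise = trans (∨-cong (¬-cong (sym (H-∧ X Y))) (sym (H-∧ X Z)))
                    (trans (sym (H-⇒ _ _)) p)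

  part-i : ∀ X → Any Holds ((¬c X) ∷ ([ X ] X) ∷ [])
  part-i X with self-conditional (H X)
  ... | inj₁ conditional-valid = there (here (trans (H-[] X X) conditional-valid))
  ... | inj₂ ¬X-valid          = here (¬c-holds ¬X-valid)

  part-i′ : ∀ X → Holds (([ X ] X) ⇔c X) → Any Holds ((¬c X) ∷ X ∷ [])
  part-i′ X p with part-i X
  ... | here ¬X-holds          = here ¬X-holds
  ... | there (here XX-holds)  = there (here (trans (sym (biconditional-holds p)) XX-holds))

  part-ii : ∀ X Y → Holds (([ X ] Y) ⇔c Y) → Holds (X ⇒ Y) →
    Any Holds ((¬c X) ∷ Y ∷ [])
  part-ii X Y p q with independent-consequence (independence-holds p) (implication-holds q)
  ... | inj₁ ¬X-valid = here (¬c-holds ¬X-valid)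
  ... | inj₂ Y-valid  = there (here Y-valid)

  -- Here the dichotomy is applied to ∼H X, of which H Y is also independent.
  part-iii : ∀ X Y → Holds (([ X ] Y) ⇔c Y) → Holds (X ∨c Y) →
    Any Holds (X ∷ Y ∷ [])
  part-iii X Y p q with independent-consequence (independent-complement (independence-holds p)) ¬X⊆Y
    where
    ¬X⊆Y : ((¬ H X) ∧ H Y) ≈ (¬ H X)
    ¬X⊆Y = trans (∧-congʳ (sym (H-¬ X))) (trans (implication-holds q) (H-¬ X))
  ... | inj₁ ¬¬X-valid = here (¬¬-valid ¬¬X-valid)
  ... | inj₂ Y-valid   = there (here Y-valid)

  -- Here the dichotomy is applied to H X and H (Y → Z).
  part-iv : ∀ X Y Z → Holds ((X ∧c Y) ⇒ (X ∧c Z)) → Holds (([ X ] Y) ⇔c Y) →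
    Holds (([ X ] Z) ⇔c Z) → Any Holds ((¬c X) ∷ (Y ⇒ Z) ∷ [])
  part-iv X Y Z p q r with independent-consequence independent (implication-holds (curry-holds p))
    where
    independent : Independent (H X) (H (Y ⇒ Z))
    independent = independent-resp (sym (H-⇒ Y Z))
      (independent-implication (independence-holds q) (independence-holds r))
  ... | inj₁ ¬X-valid  = here (¬c-holds ¬X-valid)
  ... | inj₂ YZ-valid  = there (here YZ-valid)

-- Adding a side context Γ to a rule: if Γ ++ [B] has a true member, either
-- Γ does, or B is true; in the latter case the rule must supply the conclusion.
module ContextRules {a p : Level} {C : Set a} {P : C → Set p} where

  context-cut : ∀ Γ {B Δ} → (P B → Any P (Γ ++ Δ)) → Any P (Γ ++ B ∷ []) → Any P (Γ ++ Δ)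
  context-cut Γ use-B premise with ++⁻ Γ premise
  ... | inj₁ in-context = ++⁺ˡ in-context
  ... | inj₂ (here b)   = use-B b

  context-rule₁ : ∀ Γ {B Δ} → (P B → Any P Δ) → Any P (Γ ++ B ∷ []) → Any P (Γ ++ Δ)
  context-rule₁ Γ rule = context-cut Γ (λ b → ++⁺ʳ Γ (rule b))

  context-rule₂ : ∀ Γ {B B′ Δ} → (P B → P B′ → Any P Δ) →
    Any P (Γ ++ B ∷ []) → Any P (Γ ++ B′ ∷ []) → Any P (Γ ++ Δ)
  context-rule₂ Γ rule premise premise′ =
    context-cut Γ (λ b → context-rule₁ Γ (rule b) premise′) premise

  context-rule₃ : ∀ Γ {B B′ B″ Δ} → (P B → P B′ → P B″ → Any P Δ) →
    Any P (Γ ++ B ∷ []) → Any P (Γ ++ B′ ∷ []) → Any P (Γ ++ B″ ∷ []) → Any P (Γ ++ Δ)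
  context-rule₃ Γ rule premise premise′ premise″ =
    context-cut Γ (λ b → context-rule₂ Γ (rule b) premise′ premise″) premise

open ContextRules
open Pointwise

mainTheorem14 : ∀ {A : Set} (X Y Z : Cond A) (Γ : List (Cond A)) →
  ⊨ ((¬c X) ∷ ([ X ] X) ∷ [])
  ×ω (⊨ (Γ ++ ((([ X ] X) ⇔c X) ∷ [])) → ⊨ (Γ ++ ((¬c X) ∷ X ∷ [])))
  ×ω (⊨ (Γ ++ ((([ X ] Y) ⇔c Y) ∷ [])) → ⊨ (Γ ++ ((X ⇒ Y) ∷ []))
        → ⊨ (Γ ++ ((¬c X) ∷ Y ∷ [])))
  ×ω (⊨ (Γ ++ ((([ X ] Y) ⇔c Y) ∷ [])) → ⊨ (Γ ++ ((X ∨c Y) ∷ []))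
        → ⊨ (Γ ++ (X ∷ Y ∷ [])))
  ×ω (⊨ (Γ ++ (((X ∧c Y) ⇒ (X ∧c Z)) ∷ [])) → ⊨ (Γ ++ ((([ X ] Y) ⇔c Y) ∷ []))
        → ⊨ (Γ ++ ((([ X ] Z) ⇔c Z) ∷ []))
        → ⊨ (Γ ++ ((¬c X) ∷ (Y ⇒ Z) ∷ [])))
mainTheorem14 X Y Z Γ =
      (λ E V → part-i E V X)
  ,ω ((λ p E V → context-rule₁ Γ (part-i′ E V X) (p E V))
  ,ω ((λ p q E V → context-rule₂ Γ (part-ii E V X Y) (p E V) (q E V))
  ,ω ((λ p q E V → context-rule₂ Γ (part-iii E V X Y) (p E V) (q E V))
  ,ω  (λ p q r E V → context-rule₃ Γ (part-iv E V X Y Z) (p E V) (q E V) (r E V)))))
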